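{- Assume $|\mathcal{A}|\geq 2$ and let $n\geq 2$. Then $n$-nested trace equivalence $\sim^n_{\mathtt{T}}$ and $n$-nested simulation equivalence $\sim^n_{\mathtt{S}}$ admit no finite, ground-complete, equational axiomatisation over $\mathrm{BCCSP}_{\|}$.
   Context: Let $\mathcal{A}$ be a finite non-empty set of actions and $\mathcal{V}$ a countably infinite set of variables. $\mathrm{BCCSP}_{\|}$ terms: $t ::= \mathbf{0} \mid x \mid a.t \mid t+t \mid t \,\|\, t$ ($a\in\mathcal{A}$, $x\in\mathcal{V}$). Closed terms are processes. Transitions: $a.p \xrightarrow{a} p$; if $p \xrightarrow{a} p'$ then $p+q \xrightarrow{a} p'$, $q+p \xrightarrow{a} p'$, $p\|q \xrightarrow{a} p'\|q$, $q \| p \xrightarrow{a} q \| p'$. For $\alpha\in\mathcal{A}^*$, $p\xrightarrow{\alpha}p'$ denotes a path labelled $\alpha$. $n$-nested trace equivalence: $p\sim^0_{\mathtt{T}}q$ for all $p,q$; $p\sim^{n+1}_{\mathtt{T}}q$ iff for all $\alpha\in\mathcal{A}^*$, $p\xrightarrow{\alpha}p'$ implies $q\xrightarrow{\alpha}q'$ with $p'\sim^n_{\mathtt{T}}q'$ for some $q'$, and $q\xrightarrow{\alpha}q'$ implies $p\xrightarrow{\alpha}p'$ with $p'\sim^n_{\mathtt{T}}q'$ for some $p'$. A simulation is a relation $S$ with $pSq$, $p\xrightarrow{a}p'$ implying $q\xrightarrow{a}q'$ and $p'Sq'$ for some $q'$. $p\sqsubseteq^0_{\mathtt{S}}q$ for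 all $p,q$; $p\sqsubseteq^{n+1}_{\mathtt{S}}q$ iff $pSq$ for some simulation $S$ with $S^{ -1}\subseteq\sqsubseteq^n_{\mathtt{S}}$; $\sim^n_{\mathtt{S}}={\sqsubseteq^n_{\mathtt{S}}}\cap(\sqsubseteq^n_{\mathtt{S}})^{ -1}$. A finite ground-complete axiomatisation of a relation $R$ is a finite set $\mathcal{E}$ of equations between terms that is sound modulo $R$ ($\sigma(t)R\sigma(u)$ for every equation $t\approx u$ in $\mathcal{E}$ and every closed substitution $\sigma$) and such that $pRq$ implies $\mathcal{E}\vdash p\approx q$ for all closed $p,q$, where $\vdash$ denotes derivability in equational logic (reflexivity, symmetry, transitivity, substitution instances, closure under $a.\_$, $+$, $\|$). -}

module Defs where

open import Level using (Level; _⊔_) renaming (suc to lsuc; zero to lzero)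
open import Data.Nat using (ℕ; zero; suc)
open import Data.Fin using (Fin)
open import Data.Empty using (⊥)
open import Data.Unit using (⊤)
open import Data.List using (List; []; _∷_)
open import Data.List.Membership.Propositional using (_∈_)
open import Data.Product using (Σ; _×_; _,_; ∃)
open import Relation.Nullary using (¬_)

-- Actions: the finite set 𝒜 is represented as Fin k (|𝒜| = k).
-- Variables 𝒱: ℕ (countably infinite).

module _ (k : ℕ) where

  Act : Set
  Act = Fin k

  data Term (V : Set) : Set where
    𝟎    : Term V
    var  : V → Term V
    _·_  : Act → Term V → Term V
    _⊕_  : Term V → Term V → Term V
    _∥_  : Term V → Term V → Term V

  OTerm : Set
  OTerm = Term ℕ

  Proc : Set
  Proc = Term ⊥

  _[_] : {V W : Set} → Term V → (V → Term W) → Term W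
  𝟎 [ σ ] = 𝟎
  var x [ σ ] = σ x
  (a · t) [ σ ] = a · (t [ σ ])
  (t ⊕ u) [ σ ] = (t [ σ ]) ⊕ (u [ σ ])
  (t ∥ u) [ σ ] = (t [ σ ]) ∥ (u [ σ ])

  emb : Proc → OTerm
  emb p = p [ (λ ()) ]

  data _—[_]→_ : Proc → Act → Proc → Set where
    pre  : ∀ {a p} → (a · p) —[ a ]→ p
    sumˡ : ∀ {a p p' q} → p —[ a ]→ p' → (p ⊕ q) —[ a ]→ p'
    sumʳ : ∀ {a p p' q} → p —[ a ]→ p' → (q ⊕ p) —[ a ]→ p'
    parˡ : ∀ {a p p' q} → p —[ a ]→ p' → (p ∥ q) —[ a ]→ (p' ∥ q)
    parʳ : ∀ {a p p' q} → p —[ a ]→ p' → (q ∥ p) —[ a ]→ (q ∥ p')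

  data _—[_]→*_ : Proc → List Act → Proc → Set where
    nil  : ∀ {p} → p —[ [] ]→* p
    cons : ∀ {a α p p' p''} → p —[ a ]→ p' → p' —[ α ]→* p'' → p —[ a ∷ α ]→* p''

  _∼T[_]_ : Proc → ℕ → Proc → Set
  p ∼T[ zero ] q = ⊤
  p ∼T[ suc n ] q =
    (∀ α p' → p —[ α ]→* p' → Σ Proc λ q' → (q —[ α ]→* q') × (p' ∼T[ n ] q')) ×
    (∀ α q' → q —[ α ]→* q' → Σ Proc λ p' → (p —[ α ]→* p') × (p' ∼T[ n ] q'))

  IsSimulation : (Proc → Proc → Set) → Set
  IsSimulation S = ∀ p q a p' → S p q → p —[ a ]→ p' →
                   Σ Proc λ q' → (q —[ a ]→ q') × S p' q'

  _⊑S[_]_ : Proc → ℕ → Proc → Set₁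
  p ⊑S[ zero ] q = Level.Lift _ ⊤
  p ⊑S[ suc n ] q = Σ (Proc → Proc → Set) λ S →
    IsSimulation S × S p q × (∀ r s → S r s → s ⊑S[ n ] r)

  _∼S[_]_ : Proc → ℕ → Proc → Set₁
  p ∼S[ n ] q = (p ⊑S[ n ] q) × (q ⊑S[ n ] p)

  Equation : Set
  Equation = OTerm × OTerm

  data _⊢_≈_ (E : List Equation) : OTerm → OTerm → Set where
    ax    : ∀ {t u} → (t , u) ∈ E → E ⊢ t ≈ u
    refl  : ∀ {t} → E ⊢ t ≈ t
    sym   : ∀ {t u} → E ⊢ t ≈ u → E ⊢ u ≈ t
    trans : ∀ {t u v} → E ⊢ t ≈ u → E ⊢ u ≈ v → E ⊢ t ≈ v
    inst  : ∀ {t u} (σ : ℕ → OTerm) → E ⊢ t ≈ u → E ⊢ (t [ σ ]) ≈ (u [ σ ])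
    cong· : ∀ {t u} (a : Act) → E ⊢ t ≈ u → E ⊢ (a · t) ≈ (a · u)
    cong⊕ : ∀ {t t' u u'} → E ⊢ t ≈ t' → E ⊢ u ≈ u' → E ⊢ (t ⊕ u) ≈ (t' ⊕ u')
    cong∥ : ∀ {t t' u u'} → E ⊢ t ≈ t' → E ⊢ u ≈ u' → E ⊢ (t ∥ u) ≈ (t' ∥ u')

  SoundModulo : {ℓ : Level} → (Proc → Proc → Set ℓ) → List Equation → Set ℓ
  SoundModulo R E = ∀ t u → (t , u) ∈ E → (σ : ℕ → Proc) → R (t [ σ ]) (u [ σ ])

  GroundComplete : {ℓ : Level} → (Proc → Proc → Set ℓ) → List Equation → Set ℓ
  GroundComplete R E = ∀ p q → R p q → E ⊢ emb p ≈ emb q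

  -- R has a finite ground-complete axiomatisation (finite set = list)
  HasFiniteGroundCompleteAxiomatisation : {ℓ : Level} → (Proc → Proc → Set ℓ) → Set ℓ
  HasFiniteGroundCompleteAxiomatisation R =
    Σ (List Equation) λ E → SoundModulo R E × GroundComplete R E

-- For N ≥ 1 let Bᵢ = bⁱ.a.0 and
--   L N = a.0 ∥ Σ_{1≤i≤N} a.Bᵢ   and   R N = a.(0 ∥ Σ_{1≤i≤N} a.Bᵢ) + Σ_{1≤i≤N} a.(a.0 ∥ Bᵢ).
-- Both sides have literally the same transitions, so they are related by every ∼ⁿ_T and ∼ⁿ_S.
-- For n ≥ 2 these relations are contained in the congruence ≈F ("same initial steps up to trace
-- equivalence of the derivatives"), so a finite E sound for them is sound modulo ≈F.  Let N exceed
-- the size of every term in E.  L N has a parallel summand s₁ ∥ s₂ of live processes that can mimic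
-- every step of L N, while R N has no parallel summand at all.  Having such a summand (for processes
-- that can be mimicked by L N) is preserved by every instance of an axiom of E: the summand either
-- comes from a variable, or from a parallel subterm of the axiom, which has fewer than N prefixes and
-- therefore must obtain one of the N pairwise trace-inequivalent a-derivatives a.0 ∥ Bᵢ of L N from a
-- variable; instantiating that variable with b.0 and using soundness shows that the other side of the
-- axiom must also place the variable under a live parallel composition, which again mimics L N.
-- Hence E ⊢ L N ≈ R N is impossible.

module Submission where

open import Data.Bool using (true; false; if_then_else_)
open import Data.Empty using (⊥; ⊥-elim)
open import Data.Fin using (Fin; zero; suc; toℕ; _≟_)
open import Data.Fin.Properties using (toℕ<n; pigeonhole)
open import Data.List using (List; []; _∷_; _++_; length; map; replicate; lookup)
open import Data.List.Membership.Propositional using (_∈_)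
open import Data.List.Membership.Propositional.Properties using (∈-map⁺; ∈-++⁺ˡ; ∈-++⁺ʳ)
open import Data.List.Properties using (length-map; length-++)
open import Data.List.Relation.Ternary.Interleaving.Propositional
  using (Interleaving; []; consˡ; consʳ; swap)
open import Data.List.Relation.Unary.Any using (here; there; index)
open import Data.List.Relation.Unary.Any.Properties using (lookup-index)
import Data.Nat as ℕ
open import Data.Nat using (ℕ; zero; suc; _+_; _≤_; _<_; z≤n; s≤s)
open import Data.Nat.Properties
  using (≤-refl; ≤-reflexive; ≤-trans; <-irrefl; +-comm; +-identityʳ; +-suc; +-mono-≤;
         n≤1+n; m≤m+n; m≤n+m; m≤n⇒m<n∨m≡n; m≤n⇒m≤1+n)
open import Data.Product using (∃; ∃₂; _×_; _,_; -,_; proj₁; proj₂)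
open import Data.Sum using (_⊎_; inj₁; inj₂; [_,_]′)
open import Data.Unit using (tt)
open import Function using (_∘_)
open import Level using (lift)
open import Relation.Binary.PropositionalEquality as ≡ using (_≡_; refl; cong; cong₂; subst; subst₂)
open import Relation.Nullary using (¬_; Dec; yes; no; does)

open import Defs

all-or-some : ∀ n {X : Fin n → Set} {Y : Set} → (∀ i → X i ⊎ Y) → (∀ i → X i) ⊎ Y
all-or-some zero f = inj₁ (λ ())
all-or-some (suc n) {X} f with f zero | all-or-some n {X ∘ suc} (f ∘ suc)
... | inj₂ y | _ = inj₂ y
... | inj₁ _ | inj₂ y = inj₂ y
... | inj₁ x₀ | inj₁ xs = inj₁ λ { zero → x₀ ; (suc i) → xs i }

module Processes (k : ℕ) where

  A : Set
  A = Act k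

  P : Set
  P = Proc k

  O : Set
  O = OTerm k

  infix 4 _⇒[_]_ _⇒*[_]_
  infixl 30 _⟪_⟫

  _⇒[_]_ : P → A → P → Set
  _⇒[_]_ = _—[_]→_ k

  _⇒*[_]_ : P → List A → P → Set
  _⇒*[_]_ = _—[_]→*_ k

  _⟪_⟫ : {V W : Set} → Term k V → (V → Term k W) → Term k W
  _⟪_⟫ = _[_] k

  private variable
    c : A
    α β γ : List A
    p p' q q' r s : P
    σ σ' : ℕ → P

  Tr : P → List A → Set
  Tr p α = ∃ (p ⇒*[ α ]_)

  infix 4 _⊆Tr_ _≃Tr_

  _⊆Tr_ _≃Tr_ : P → P → Set
  p ⊆Tr q = ∀ {α} → Tr p α → Tr q α
  p ≃Tr q = p ⊆Tr q × q ⊆Tr p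

  ≃Tr-refl : p ≃Tr p
  ≃Tr-refl = (λ t → t) , (λ t → t)

  ≃Tr-sym : p ≃Tr q → q ≃Tr p
  ≃Tr-sym (f , g) = g , f

  ≃Tr-trans : p ≃Tr q → q ≃Tr r → p ≃Tr r
  ≃Tr-trans (f , g) (f' , g') = (λ t → f' (f t)) , (λ t → g (g' t))

  Tr-∷ : p ⇒[ c ] p' → Tr p' α → Tr p (c ∷ α)
  Tr-∷ s (_ , π) = -, cons s π

  Tr-step : p ⇒[ c ] p' → Tr p (c ∷ [])
  Tr-step s = Tr-∷ s (-, nil)

  ⇒*-++ : p ⇒*[ α ] q → q ⇒*[ β ] r → p ⇒*[ α ++ β ] r
  ⇒*-++ nil ρ = ρ
  ⇒*-++ (cons s π) ρ = cons s (⇒*-++ π ρ)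

  ⇒*-∥ˡ : p ⇒*[ α ] p' → (p ∥ q) ⇒*[ α ] (p' ∥ q)
  ⇒*-∥ˡ nil = nil
  ⇒*-∥ˡ (cons s π) = cons (parˡ s) (⇒*-∥ˡ π)

  ⇒*-∥ʳ : q ⇒*[ α ] q' → (p ∥ q) ⇒*[ α ] (p ∥ q')
  ⇒*-∥ʳ nil = nil
  ⇒*-∥ʳ (cons s π) = cons (parʳ s) (⇒*-∥ʳ π)

  Tr-∥ˡ : Tr p α → Tr (p ∥ q) α
  Tr-∥ˡ (_ , π) = -, ⇒*-∥ˡ π

  Tr-∥ʳ : Tr q α → Tr (p ∥ q) α
  Tr-∥ʳ (_ , π) = -, ⇒*-∥ʳ π

  Alive : P → Set
  Alive p = ∃₂ λ c p' → p ⇒[ c ] p'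

  alive? : (p : P) → Dec (Alive p)
  alive? 𝟎 = no λ { (_ , _ , ()) }
  alive? (c · p) = yes (c , p , pre)
  alive? (p ⊕ q) with alive? p | alive? q
  ... | yes (_ , _ , s) | _ = yes (-, -, sumˡ s)
  ... | no _ | yes (_ , _ , s) = yes (-, -, sumʳ s)
  ... | no ¬p | no ¬q = no λ { (_ , _ , sumˡ s) → ¬p (-, -, s) ; (_ , _ , sumʳ s) → ¬q (-, -, s) }
  alive? (p ∥ q) with alive? p | alive? q
  ... | yes (_ , _ , s) | _ = yes (-, -, parˡ s)
  ... | no _ | yes (_ , _ , s) = yes (-, -, parʳ s)
  ... | no ¬p | no ¬q = no λ { (_ , _ , parˡ s) → ¬p (-, -, s) ; (_ , _ , parʳ s) → ¬q (-, -, s) }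

  Alive-∥-deadʳ : Alive (p ∥ q) → ¬ Alive q → Alive p
  Alive-∥-deadʳ (_ , _ , parˡ s) ¬q = -, -, s
  Alive-∥-deadʳ (_ , _ , parʳ s) ¬q = ⊥-elim (¬q (-, -, s))

  Alive-∥-deadˡ : Alive (p ∥ q) → ¬ Alive p → Alive q
  Alive-∥-deadˡ (_ , _ , parʳ s) ¬p = -, -, s
  Alive-∥-deadˡ (_ , _ , parˡ s) ¬p = ⊥-elim (¬p (-, -, s))

  ⊆Tr-Alive : p ⊆Tr q → Alive p → Alive q
  ⊆Tr-Alive p⊆q (_ , _ , s) with p⊆q (Tr-step s)
  ... | _ , cons s' nil = -, -, s'

  Alive-⟪⟫ : (∀ x → Alive (σ x) → Alive (σ' x)) → (t : O) → Alive (t ⟪ σ ⟫) → Alive (t ⟪ σ' ⟫)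
  Alive-⟪⟫ σ⇒σ' (var x) al = σ⇒σ' x al
  Alive-⟪⟫ σ⇒σ' (c · t) al = -, -, pre
  Alive-⟪⟫ σ⇒σ' (t ⊕ u) (_ , _ , sumˡ s) with Alive-⟪⟫ σ⇒σ' t (-, -, s)
  ... | _ , _ , s' = -, -, sumˡ s'
  Alive-⟪⟫ σ⇒σ' (t ⊕ u) (_ , _ , sumʳ s) with Alive-⟪⟫ σ⇒σ' u (-, -, s)
  ... | _ , _ , s' = -, -, sumʳ s'
  Alive-⟪⟫ σ⇒σ' (t ∥ u) (_ , _ , parˡ s) with Alive-⟪⟫ σ⇒σ' t (-, -, s)
  ... | _ , _ , s' = -, -, parˡ s'
  Alive-⟪⟫ σ⇒σ' (t ∥ u) (_ , _ , parʳ s) with Alive-⟪⟫ σ⇒σ' u (-, -, s)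
  ... | _ , _ , s' = -, -, parʳ s'

  ∥-deadˡ-⊆Tr : ¬ Alive p → (p ∥ q) ⊆Tr q
  ∥-deadˡ-⊆Tr ¬p (_ , nil) = -, nil
  ∥-deadˡ-⊆Tr ¬p (_ , cons (parˡ s) π) = ⊥-elim (¬p (-, -, s))
  ∥-deadˡ-⊆Tr ¬p (_ , cons (parʳ s) π) = Tr-∷ s (∥-deadˡ-⊆Tr ¬p (-, π))

  ∥-deadʳ-⊆Tr : ¬ Alive q → (p ∥ q) ⊆Tr p
  ∥-deadʳ-⊆Tr ¬q (_ , nil) = -, nil
  ∥-deadʳ-⊆Tr ¬q (_ , cons (parʳ s) π) = ⊥-elim (¬q (-, -, s))
  ∥-deadʳ-⊆Tr ¬q (_ , cons (parˡ s) π) = Tr-∷ s (∥-deadʳ-⊆Tr ¬q (-, π))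

  ∥-deadˡ-≃Tr : ¬ Alive p → (p ∥ q) ≃Tr q
  ∥-deadˡ-≃Tr ¬p = ∥-deadˡ-⊆Tr ¬p , Tr-∥ʳ

  ∥-deadʳ-≃Tr : ¬ Alive q → (p ∥ q) ≃Tr p
  ∥-deadʳ-≃Tr ¬q = ∥-deadʳ-⊆Tr ¬q , Tr-∥ˡ

  Tr-∥-no-initialˡ : ∀ m → (∀ {p'} → ¬ p ⇒[ c ] p') →
                     Tr (p ∥ r) (replicate m c) → Tr r (replicate m c)
  Tr-∥-no-initialˡ zero _ _ = -, nil
  Tr-∥-no-initialˡ (suc m) no-c (_ , cons (parˡ s) π) = ⊥-elim (no-c s)
  Tr-∥-no-initialˡ (suc m) no-c (_ , cons (parʳ s) π) = Tr-∷ s (Tr-∥-no-initialˡ m no-c (-, π))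

  Tr-∥-interleaving : Tr (p ∥ q) α → ∃₂ λ β γ → Interleaving β γ α × Tr p β × Tr q γ
  Tr-∥-interleaving (_ , nil) = [] , [] , [] , (-, nil) , (-, nil)
  Tr-∥-interleaving (_ , cons (parˡ s) π) with Tr-∥-interleaving (-, π)
  ... | _ , _ , i , tp , tq = -, -, consˡ i , Tr-∷ s tp , tq
  Tr-∥-interleaving (_ , cons (parʳ s) π) with Tr-∥-interleaving (-, π)
  ... | _ , _ , i , tp , tq = -, -, consʳ i , tp , Tr-∷ s tq

  interleaving-Tr-∥ : Interleaving β γ α → Tr p β → Tr q γ → Tr (p ∥ q) α
  interleaving-Tr-∥ [] _ _ = -, nil
  interleaving-Tr-∥ (consˡ i) (_ , cons s π) tq = Tr-∷ (parˡ s) (interleaving-Tr-∥ i (-, π) tq)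
  interleaving-Tr-∥ (consʳ i) tp (_ , cons s π) = Tr-∷ (parʳ s) (interleaving-Tr-∥ i tp (-, π))

  ∥-mono-⊆Tr : p ⊆Tr p' → q ⊆Tr q' → (p ∥ q) ⊆Tr (p' ∥ q')
  ∥-mono-⊆Tr f g t with Tr-∥-interleaving t
  ... | _ , _ , i , tp , tq = interleaving-Tr-∥ i (f tp) (g tq)

  ∥-cong-≃Tr : p ≃Tr p' → q ≃Tr q' → (p ∥ q) ≃Tr (p' ∥ q')
  ∥-cong-≃Tr (f , g) (f' , g') = ∥-mono-⊆Tr f f' , ∥-mono-⊆Tr g g'

  ∥-comm-⊆Tr : (p ∥ q) ⊆Tr (q ∥ p)
  ∥-comm-⊆Tr t with Tr-∥-interleaving t
  ... | _ , _ , i , tp , tq = interleaving-Tr-∥ (swap i) tq tp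

  ∥-comm-≃Tr : (p ∥ q) ≃Tr (q ∥ p)
  ∥-comm-≃Tr = ∥-comm-⊆Tr , ∥-comm-⊆Tr

  -- One-step futures

  infix 4 _⊑F_ _≈F_

  _⊑F_ _≈F_ : P → P → Set
  p ⊑F q = ∀ {c p'} → p ⇒[ c ] p' → ∃ λ q' → q ⇒[ c ] q' × p' ≃Tr q'
  p ≈F q = p ⊑F q × q ⊑F p

  ⊑F-refl : p ⊑F p
  ⊑F-refl s = -, s , ≃Tr-refl

  ⊑F-trans : p ⊑F q → q ⊑F r → p ⊑F r
  ⊑F-trans p⊑q q⊑r s with p⊑q s
  ... | _ , s' , e with q⊑r s'
  ... | _ , s'' , e' = -, s'' , ≃Tr-trans e e'

  ≈F-refl : p ≈F p
  ≈F-refl = ⊑F-refl , ⊑F-refl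

  ≈F-sym : p ≈F q → q ≈F p
  ≈F-sym (f , g) = g , f

  ≈F-trans : p ≈F q → q ≈F r → p ≈F r
  ≈F-trans (f , g) (f' , g') = ⊑F-trans f f' , ⊑F-trans g' g

  ⊑F-⊆Tr : p ⊑F q → p ⊆Tr q
  ⊑F-⊆Tr p⊑q (_ , nil) = -, nil
  ⊑F-⊆Tr p⊑q (_ , cons s π) with p⊑q s
  ... | _ , s' , (f , _) = Tr-∷ s' (f (-, π))

  ≈F-≃Tr : p ≈F q → p ≃Tr q
  ≈F-≃Tr (f , g) = ⊑F-⊆Tr f , ⊑F-⊆Tr g

  ⊑F-Alive : p ⊑F q → Alive p → Alive q
  ⊑F-Alive p⊑q = ⊆Tr-Alive (⊑F-⊆Tr p⊑q)

  ·-cong-≈F : ∀ c → p ≃Tr q → (c · p) ≈F (c · q)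
  ·-cong-≈F c e = (λ { pre → -, pre , e }) , (λ { pre → -, pre , ≃Tr-sym e })

  ⊕-mono-⊑F : p ⊑F p' → q ⊑F q' → (p ⊕ q) ⊑F (p' ⊕ q')
  ⊕-mono-⊑F f g (sumˡ s) with f s
  ... | _ , s' , e = -, sumˡ s' , e
  ⊕-mono-⊑F f g (sumʳ s) with g s
  ... | _ , s' , e = -, sumʳ s' , e

  ∥-mono-⊑F : p ⊑F p' → q ⊑F q' → p ≃Tr p' → q ≃Tr q' → (p ∥ q) ⊑F (p' ∥ q')
  ∥-mono-⊑F f g ep eq (parˡ s) with f s
  ... | _ , s' , e = -, parˡ s' , ∥-cong-≃Tr e eq
  ∥-mono-⊑F f g ep eq (parʳ s) with g s
  ... | _ , s' , e = -, parʳ s' , ∥-cong-≃Tr ep e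

  ⊕-cong-≈F : p ≈F p' → q ≈F q' → (p ⊕ q) ≈F (p' ⊕ q')
  ⊕-cong-≈F (f , g) (f' , g') = ⊕-mono-⊑F f f' , ⊕-mono-⊑F g g'

  ∥-cong-≈F : p ≈F p' → q ≈F q' → (p ∥ q) ≈F (p' ∥ q')
  ∥-cong-≈F ep@(f , g) eq@(f' , g') =
    ∥-mono-⊑F f f' (≈F-≃Tr ep) (≈F-≃Tr eq) ,
    ∥-mono-⊑F g g' (≃Tr-sym (≈F-≃Tr ep)) (≃Tr-sym (≈F-≃Tr eq))

  ∥-comm-⊑F : (p ∥ q) ⊑F (q ∥ p)
  ∥-comm-⊑F (parˡ s) = -, parʳ s , ∥-comm-≃Tr
  ∥-comm-⊑F (parʳ s) = -, parˡ s , ∥-comm-≃Tr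

  ⟪⟫-⟪⟫ : {V W X : Set} (t : Term k V) (τ : V → Term k W) (σ : W → Term k X) →
          (t ⟪ τ ⟫) ⟪ σ ⟫ ≡ t ⟪ (λ z → τ z ⟪ σ ⟫) ⟫
  ⟪⟫-⟪⟫ 𝟎 τ σ = refl
  ⟪⟫-⟪⟫ (var x) τ σ = refl
  ⟪⟫-⟪⟫ (c · t) τ σ = cong (c ·_) (⟪⟫-⟪⟫ t τ σ)
  ⟪⟫-⟪⟫ (t ⊕ u) τ σ = cong₂ _⊕_ (⟪⟫-⟪⟫ t τ σ) (⟪⟫-⟪⟫ u τ σ)
  ⟪⟫-⟪⟫ (t ∥ u) τ σ = cong₂ _∥_ (⟪⟫-⟪⟫ t τ σ) (⟪⟫-⟪⟫ u τ σ)

  closed-⟪⟫ : (p : P) (σ : ⊥ → P) → p ⟪ σ ⟫ ≡ p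
  closed-⟪⟫ 𝟎 σ = refl
  closed-⟪⟫ (c · p) σ = cong (c ·_) (closed-⟪⟫ p σ)
  closed-⟪⟫ (p ⊕ q) σ = cong₂ _⊕_ (closed-⟪⟫ p σ) (closed-⟪⟫ q σ)
  closed-⟪⟫ (p ∥ q) σ = cong₂ _∥_ (closed-⟪⟫ p σ) (closed-⟪⟫ q σ)

  emb-⟪⟫ : (p : P) (σ : ℕ → P) → emb k p ⟪ σ ⟫ ≡ p
  emb-⟪⟫ p σ = ≡.trans (⟪⟫-⟪⟫ p (λ ()) σ) (closed-⟪⟫ p _)

  ⊢-sound-≈F : ∀ {E t u} → SoundModulo k _≈F_ E → _⊢_≈_ k E t u → ∀ σ → t ⟪ σ ⟫ ≈F u ⟪ σ ⟫
  ⊢-sound-≈F E-sound (ax t≈u∈E) σ = E-sound _ _ t≈u∈E σ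
  ⊢-sound-≈F E-sound refl σ = ≈F-refl
  ⊢-sound-≈F E-sound (sym d) σ = ≈F-sym (⊢-sound-≈F E-sound d σ)
  ⊢-sound-≈F E-sound (trans d d') σ = ≈F-trans (⊢-sound-≈F E-sound d σ) (⊢-sound-≈F E-sound d' σ)
  ⊢-sound-≈F E-sound (inst {t} {u} τ d) σ =
    subst₂ _≈F_ (≡.sym (⟪⟫-⟪⟫ t τ σ)) (≡.sym (⟪⟫-⟪⟫ u τ σ))
           (⊢-sound-≈F E-sound d (λ z → τ z ⟪ σ ⟫))
  ⊢-sound-≈F E-sound (cong· c d) σ = ·-cong-≈F c (≈F-≃Tr (⊢-sound-≈F E-sound d σ))
  ⊢-sound-≈F E-sound (cong⊕ d d') σ =
    ⊕-cong-≈F (⊢-sound-≈F E-sound d σ) (⊢-sound-≈F E-sound d' σ)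
  ⊢-sound-≈F E-sound (cong∥ d d') σ =
    ∥-cong-≈F (⊢-sound-≈F E-sound d σ) (⊢-sound-≈F E-sound d' σ)

  ∼T-≃Tr : ∀ n → _∼T[_]_ k p (suc n) q → p ≃Tr q
  ∼T-≃Tr n (f , g) =
    (λ (_ , π) → let (_ , π' , _) = f _ _ π in -, π') ,
    (λ (_ , π) → let (_ , π' , _) = g _ _ π in -, π')

  ∼T-≈F : ∀ n → _∼T[_]_ k p (suc (suc n)) q → p ≈F q
  ∼T-≈F n (f , g) = match (∼T-≃Tr n) f , match (λ e → ≃Tr-sym (∼T-≃Tr n e)) g
    where
      match : ∀ {p q} {R : P → P → Set} → (∀ {x y} → R x y → x ≃Tr y) →
              (∀ α p' → p ⇒*[ α ] p' → ∃ λ q' → q ⇒*[ α ] q' × R p' q') → p ⊑F q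
      match R⇒≃Tr f s with f _ _ (cons s nil)
      ... | _ , cons s' nil , e = -, s' , R⇒≃Tr e

  simulation-⊆Tr : ∀ {S} → IsSimulation k S → S p q → p ⊆Tr q
  simulation-⊆Tr sim pSq (_ , nil) = -, nil
  simulation-⊆Tr sim pSq (_ , cons s π) with sim _ _ _ _ pSq s
  ... | _ , s' , p'Sq' = Tr-∷ s' (simulation-⊆Tr sim p'Sq' (-, π))

  ⊑S-⊆Tr : ∀ n → _⊑S[_]_ k p (suc n) q → p ⊆Tr q
  ⊑S-⊆Tr n (_ , sim , pSq , _) = simulation-⊆Tr sim pSq

  ⊑S-⊑F : ∀ n → _⊑S[_]_ k p (suc (suc n)) q → p ⊑F q
  ⊑S-⊑F n (_ , sim , pSq , S⁻¹⊑S) s with sim _ _ _ _ pSq s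
  ... | _ , s' , p'Sq' = -, s' , (simulation-⊆Tr sim p'Sq' , ⊑S-⊆Tr n (S⁻¹⊑S _ _ p'Sq'))

  ∼S-≈F : ∀ n → _∼S[_]_ k p (suc (suc n)) q → p ≈F q
  ∼S-≈F n (p⊑q , q⊑p) = ⊑S-⊑F n p⊑q , ⊑S-⊑F n q⊑p

  SameSteps : P → P → Set
  SameSteps p q = ∀ {c r} → (p ⇒[ c ] r → q ⇒[ c ] r) × (q ⇒[ c ] r → p ⇒[ c ] r)

  SameSteps-refl : SameSteps p p
  SameSteps-refl = (λ s → s) , (λ s → s)

  SameSteps-sym : SameSteps p q → SameSteps q p
  SameSteps-sym same = proj₂ same , proj₁ same

  SameSteps-∼T : ∀ n → SameSteps p q → _∼T[_]_ k p n q
  SameSteps-∼T zero same = tt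
  SameSteps-∼T (suc n) same =
    (λ α p' π → let (q' , π' , same') = match same π in q' , π' , SameSteps-∼T n same') ,
    (λ α q' π → let (p' , π' , same') = match (SameSteps-sym same) π in
                p' , π' , SameSteps-∼T n (SameSteps-sym same'))
    where
      match : ∀ {p q α p'} → SameSteps p q → p ⇒*[ α ] p' →
              ∃ λ q' → q ⇒*[ α ] q' × SameSteps p' q'
      match same nil = -, nil , same
      match same (cons s π) = -, cons (proj₁ same s) π , SameSteps-refl

  SameSteps-⊑S : ∀ n → SameSteps p q → _⊑S[_]_ k p n q
  SameSteps-⊑S zero same = lift tt
  SameSteps-⊑S (suc n) same =
    SameSteps , (λ _ _ _ _ same' s → -, proj₁ same' s , SameSteps-refl) , same ,
    (λ _ _ same' → SameSteps-⊑S n (SameSteps-sym same'))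

  SameSteps-∼S : ∀ n → SameSteps p q → _∼S[_]_ k p n q
  SameSteps-∼S n same = SameSteps-⊑S n same , SameSteps-⊑S n (SameSteps-sym same)

  -- Summands of processes and of instances of open terms

  data Summand : P → P → Set where
    self : Summand p p
    ⊕ˡ   : Summand p s → Summand (p ⊕ q) s
    ⊕ʳ   : Summand q s → Summand (p ⊕ q) s
    ∥ˡ   : Summand p s → ¬ Alive q → Summand (p ∥ q) s
    ∥ʳ   : Summand q s → ¬ Alive p → Summand (p ∥ q) s

  Summand-trans : Summand p q → Summand q s → Summand p s
  Summand-trans self y = y
  Summand-trans (⊕ˡ x) y = ⊕ˡ (Summand-trans x y)
  Summand-trans (⊕ʳ x) y = ⊕ʳ (Summand-trans x y)
  Summand-trans (∥ˡ x ¬q) y = ∥ˡ (Summand-trans x y) ¬q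
  Summand-trans (∥ʳ x ¬p) y = ∥ʳ (Summand-trans x y) ¬p

  Summand-⊑F : Summand p s → s ⊑F p
  Summand-⊑F self = ⊑F-refl
  Summand-⊑F (⊕ˡ x) st with Summand-⊑F x st
  ... | _ , st' , e = -, sumˡ st' , e
  Summand-⊑F (⊕ʳ x) st with Summand-⊑F x st
  ... | _ , st' , e = -, sumʳ st' , e
  Summand-⊑F (∥ˡ x ¬q) st with Summand-⊑F x st
  ... | _ , st' , e = -, parˡ st' , ≃Tr-trans e (≃Tr-sym (∥-deadʳ-≃Tr ¬q))
  Summand-⊑F (∥ʳ x ¬p) st with Summand-⊑F x st
  ... | _ , st' , e = -, parʳ st' , ≃Tr-trans e (≃Tr-sym (∥-deadˡ-≃Tr ¬p))

  size : O → ℕ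
  size 𝟎 = 1
  size (var x) = 1
  size (c · t) = suc (size t)
  size (t ⊕ u) = suc (size t + size u)
  size (t ∥ u) = suc (size t + size u)

  equationsSize : List (Equation k) → ℕ
  equationsSize [] = 0
  equationsSize ((t , u) ∷ E) = size t + size u + equationsSize E

  size<1+equationsSize : ∀ E t u → (t , u) ∈ E →
                         size t < suc (equationsSize E) × size u < suc (equationsSize E)
  size<1+equationsSize ((t , u) ∷ E) t u (here refl) =
    s≤s (≤-trans (m≤m+n (size t) (size u)) (m≤m+n _ (equationsSize E))) ,
    s≤s (≤-trans (m≤n+m (size u) (size t)) (m≤m+n _ (equationsSize E)))
  size<1+equationsSize ((t′ , u′) ∷ E) t u (there t≈u∈E) with size<1+equationsSize E t u t≈u∈E
  ... | t< , u< = ≤-trans t< (s≤s (m≤n+m _ _)) , ≤-trans u< (s≤s (m≤n+m _ _))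

  private variable
    x y : ℕ
    t t₁ t₂ u w : O

  data Unguarded : O → ℕ → Set where
    self : Unguarded (var x) x
    ⊕ˡ   : Unguarded t x → Unguarded (t ⊕ u) x
    ⊕ʳ   : Unguarded u x → Unguarded (t ⊕ u) x
    ∥ˡ   : Unguarded t x → Unguarded (t ∥ u) x
    ∥ʳ   : Unguarded u x → Unguarded (t ∥ u) x

  Unguarded-step : Unguarded t y → σ y ⇒[ c ] r → ∃ λ r' → t ⟪ σ ⟫ ⇒[ c ] r' × r ⊆Tr r'
  Unguarded-step self st = -, st , (λ tr → tr)
  Unguarded-step (⊕ˡ x) st with Unguarded-step x st
  ... | _ , st' , f = -, sumˡ st' , f
  Unguarded-step (⊕ʳ x) st with Unguarded-step x st
  ... | _ , st' , f = -, sumʳ st' , f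
  Unguarded-step (∥ˡ x) st with Unguarded-step x st
  ... | _ , st' , f = -, parˡ st' , (λ tr → Tr-∥ˡ (f tr))
  Unguarded-step (∥ʳ x) st with Unguarded-step x st
  ... | _ , st' , f = -, parʳ st' , (λ tr → Tr-∥ʳ (f tr))

  Unguarded-Alive : Unguarded t y → Alive (σ y) → Alive (t ⟪ σ ⟫)
  Unguarded-Alive x (_ , _ , st) = -, -, proj₁ (proj₂ (Unguarded-step x st))

  data OpenSummand (σ : ℕ → P) : O → O → Set where
    self : OpenSummand σ t t
    ⊕ˡ   : OpenSummand σ t w → OpenSummand σ (t ⊕ u) w
    ⊕ʳ   : OpenSummand σ u w → OpenSummand σ (t ⊕ u) w
    ∥ˡ   : OpenSummand σ t w → ¬ Alive (u ⟪ σ ⟫) → OpenSummand σ (t ∥ u) w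
    ∥ʳ   : OpenSummand σ u w → ¬ Alive (t ⟪ σ ⟫) → OpenSummand σ (t ∥ u) w

  OpenSummand-⟪⟫ : OpenSummand σ t w → Summand (t ⟪ σ ⟫) (w ⟪ σ ⟫)
  OpenSummand-⟪⟫ self = self
  OpenSummand-⟪⟫ (⊕ˡ x) = ⊕ˡ (OpenSummand-⟪⟫ x)
  OpenSummand-⟪⟫ (⊕ʳ x) = ⊕ʳ (OpenSummand-⟪⟫ x)
  OpenSummand-⟪⟫ (∥ˡ x ¬u) = ∥ˡ (OpenSummand-⟪⟫ x) ¬u
  OpenSummand-⟪⟫ (∥ʳ x ¬t) = ∥ʳ (OpenSummand-⟪⟫ x) ¬t

  OpenSummand-Unguarded : OpenSummand σ t w → Unguarded w y → Unguarded t y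
  OpenSummand-Unguarded self g = g
  OpenSummand-Unguarded (⊕ˡ x) g = ⊕ˡ (OpenSummand-Unguarded x g)
  OpenSummand-Unguarded (⊕ʳ x) g = ⊕ʳ (OpenSummand-Unguarded x g)
  OpenSummand-Unguarded (∥ˡ x _) g = ∥ˡ (OpenSummand-Unguarded x g)
  OpenSummand-Unguarded (∥ʳ x _) g = ∥ʳ (OpenSummand-Unguarded x g)

  OpenSummand-size : OpenSummand σ t w → size w ≤ size t
  OpenSummand-size self = ≤-refl
  OpenSummand-size (⊕ˡ x) = ≤-trans (OpenSummand-size x) (m≤n⇒m≤1+n (m≤m+n _ _))
  OpenSummand-size (⊕ʳ x) = ≤-trans (OpenSummand-size x) (m≤n⇒m≤1+n (m≤n+m _ _))
  OpenSummand-size (∥ˡ x _) = ≤-trans (OpenSummand-size x) (m≤n⇒m≤1+n (m≤m+n _ _))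
  OpenSummand-size (∥ʳ x _) = ≤-trans (OpenSummand-size x) (m≤n⇒m≤1+n (m≤n+m _ _))

  OpenSummand-live-step : OpenSummand σ t w → w ⟪ σ' ⟫ ⇒[ c ] r → Alive r →
                          ∃ λ r' → t ⟪ σ' ⟫ ⇒[ c ] r' × Alive r'
  OpenSummand-live-step self st al = -, st , al
  OpenSummand-live-step (⊕ˡ x) st al with OpenSummand-live-step x st al
  ... | _ , st' , al' = -, sumˡ st' , al'
  OpenSummand-live-step (⊕ʳ x) st al with OpenSummand-live-step x st al
  ... | _ , st' , al' = -, sumʳ st' , al'
  OpenSummand-live-step (∥ˡ x _) st al with OpenSummand-live-step x st al
  ... | _ , st' , (_ , _ , s) = -, parˡ st' , (-, -, parˡ s)
  OpenSummand-live-step (∥ʳ x _) st al with OpenSummand-live-step x st al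
  ... | _ , st' , (_ , _ , s) = -, parʳ st' , (-, -, parʳ s)

  summand-of-instance : (t : O) → Summand (t ⟪ σ ⟫) (p ∥ q) →
    (∃ λ x → OpenSummand σ t (var x) × Summand (σ x) (p ∥ q)) ⊎
    (∃₂ λ t₁ t₂ → OpenSummand σ t (t₁ ∥ t₂) × t₁ ⟪ σ ⟫ ≡ p × t₂ ⟪ σ ⟫ ≡ q)
  summand-of-instance (var x) sm = inj₁ (x , self , sm)
  summand-of-instance (t ⊕ u) (⊕ˡ sm) with summand-of-instance t sm
  ... | inj₁ (x , os , sm') = inj₁ (x , ⊕ˡ os , sm')
  ... | inj₂ (t₁ , t₂ , os , e₁ , e₂) = inj₂ (t₁ , t₂ , ⊕ˡ os , e₁ , e₂)
  summand-of-instance (t ⊕ u) (⊕ʳ sm) with summand-of-instance u sm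
  ... | inj₁ (x , os , sm') = inj₁ (x , ⊕ʳ os , sm')
  ... | inj₂ (t₁ , t₂ , os , e₁ , e₂) = inj₂ (t₁ , t₂ , ⊕ʳ os , e₁ , e₂)
  summand-of-instance (t ∥ u) self = inj₂ (t , u , self , refl , refl)
  summand-of-instance (t ∥ u) (∥ˡ sm ¬u) with summand-of-instance t sm
  ... | inj₁ (x , os , sm') = inj₁ (x , ∥ˡ os ¬u , sm')
  ... | inj₂ (t₁ , t₂ , os , e₁ , e₂) = inj₂ (t₁ , t₂ , ∥ˡ os ¬u , e₁ , e₂)
  summand-of-instance (t ∥ u) (∥ʳ sm ¬t) with summand-of-instance u sm
  ... | inj₁ (x , os , sm') = inj₁ (x , ∥ʳ os ¬t , sm')
  ... | inj₂ (t₁ , t₂ , os , e₁ , e₂) = inj₂ (t₁ , t₂ , ∥ʳ os ¬t , e₁ , e₂)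

  UnguardedInLivePar : (ℕ → P) → O → ℕ → Set
  UnguardedInLivePar σ u y = ∃₂ λ u₁ u₂ → OpenSummand σ u (u₁ ∥ u₂) ×
    Alive (u₁ ⟪ σ ⟫) × Alive (u₂ ⟪ σ ⟫) × (Unguarded u₁ y ⊎ Unguarded u₂ y)

  private
    ∥ˡ-InLivePar : ¬ Alive (u ⟪ σ ⟫) → UnguardedInLivePar σ t y → UnguardedInLivePar σ (t ∥ u) y
    ∥ˡ-InLivePar ¬u (u₁ , u₂ , os , rest) = u₁ , u₂ , ∥ˡ os ¬u , rest

    ∥ʳ-InLivePar : ¬ Alive (t ⟪ σ ⟫) → UnguardedInLivePar σ u y → UnguardedInLivePar σ (t ∥ u) y
    ∥ʳ-InLivePar ¬t (u₁ , u₂ , os , rest) = u₁ , u₂ , ∥ʳ os ¬t , rest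

    ⊕ˡ-InLivePar : UnguardedInLivePar σ t y → UnguardedInLivePar σ (t ⊕ u) y
    ⊕ˡ-InLivePar (u₁ , u₂ , os , rest) = u₁ , u₂ , ⊕ˡ os , rest

    ⊕ʳ-InLivePar : UnguardedInLivePar σ u y → UnguardedInLivePar σ (t ⊕ u) y
    ⊕ʳ-InLivePar (u₁ , u₂ , os , rest) = u₁ , u₂ , ⊕ʳ os , rest

  unguarded-split : Alive (σ x) → Unguarded u x → OpenSummand σ u (var x) ⊎ UnguardedInLivePar σ u x
  unguarded-split al self = inj₁ self
  unguarded-split al (⊕ˡ g) with unguarded-split al g
  ... | inj₁ os = inj₁ (⊕ˡ os)
  ... | inj₂ lp = inj₂ (⊕ˡ-InLivePar lp)
  unguarded-split al (⊕ʳ g) with unguarded-split al g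
  ... | inj₁ os = inj₁ (⊕ʳ os)
  ... | inj₂ lp = inj₂ (⊕ʳ-InLivePar lp)
  unguarded-split {σ = σ} al (∥ˡ {t = t} {u = u} g) with alive? (u ⟪ σ ⟫) | unguarded-split al g
  ... | yes alu | _ = inj₂ (t , u , self , Unguarded-Alive g al , alu , inj₁ g)
  ... | no ¬u | inj₁ os = inj₁ (∥ˡ os ¬u)
  ... | no ¬u | inj₂ lp = inj₂ (∥ˡ-InLivePar ¬u lp)
  unguarded-split {σ = σ} al (∥ʳ {u = u} {t = t} g) with alive? (t ⟪ σ ⟫) | unguarded-split al g
  ... | yes alt | _ = inj₂ (t , u , self , alt , Unguarded-Alive g al , inj₂ g)
  ... | no ¬t | inj₁ os = inj₁ (∥ʳ os ¬t)
  ... | no ¬t | inj₂ lp = inj₂ (∥ʳ-InLivePar ¬t lp)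

  _[_↦_] : (ℕ → P) → ℕ → P → ℕ → P
  (σ [ y ↦ X ]) x with x ℕ.≟ y
  ... | yes _ = X
  ... | no _ = σ x

  [↦]-≡ : ∀ σ y X → (σ [ y ↦ X ]) y ≡ X
  [↦]-≡ σ y X with y ℕ.≟ y
  ... | yes _ = refl
  ... | no y≢y = ⊥-elim (y≢y refl)

  Alive-[↦]⁺ : ∀ σ y x → Alive (σ x) → Alive ((σ [ y ↦ c · q ]) x)
  Alive-[↦]⁺ σ y x al with x ℕ.≟ y
  ... | yes _ = -, -, pre
  ... | no _ = al

  Alive-[↦]⁻ : ∀ σ y X x → Alive (σ y) → Alive ((σ [ y ↦ X ]) x) → Alive (σ x)
  Alive-[↦]⁻ σ y X x aly al with x ℕ.≟ y
  ... | yes refl = aly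
  ... | no _ = al

  dead-after-update : ∀ σ y {X} → Alive (σ y) → ∀ t →
                      ¬ Alive (t ⟪ σ ⟫) → ¬ Alive (t ⟪ σ [ y ↦ X ] ⟫)
  dead-after-update σ y aly t ¬t al = ¬t (Alive-⟪⟫ (λ x → Alive-[↦]⁻ σ y _ x aly) t al)

  step-of-update : ∀ σ y X t → t ⟪ σ [ y ↦ X ] ⟫ ⇒[ c ] r → ∃ (t ⟪ σ ⟫ ⇒[ c ]_) ⊎ Unguarded t y
  step-of-update σ y X (var x) st with x ℕ.≟ y
  ... | yes refl = inj₂ self
  ... | no _ = inj₁ (-, st)
  step-of-update σ y X (c · t) pre = inj₁ (-, pre)
  step-of-update σ y X (t ⊕ u) (sumˡ st) with step-of-update σ y X t st
  ... | inj₁ (_ , s) = inj₁ (-, sumˡ s)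
  ... | inj₂ g = inj₂ (⊕ˡ g)
  step-of-update σ y X (t ⊕ u) (sumʳ st) with step-of-update σ y X u st
  ... | inj₁ (_ , s) = inj₁ (-, sumʳ s)
  ... | inj₂ g = inj₂ (⊕ʳ g)
  step-of-update σ y X (t ∥ u) (parˡ st) with step-of-update σ y X t st
  ... | inj₁ (_ , s) = inj₁ (-, parˡ s)
  ... | inj₂ g = inj₂ (∥ˡ g)
  step-of-update σ y X (t ∥ u) (parʳ st) with step-of-update σ y X u st
  ... | inj₁ (_ , s) = inj₁ (-, parʳ s)
  ... | inj₂ g = inj₂ (∥ʳ g)

  -- c · 𝟎 has only the dead derivative 𝟎, so a live derivative must pass through a live ∥-context.
  live-step-of-update : ∀ σ y → Alive (σ y) → ∀ u → u ⟪ σ [ y ↦ c · 𝟎 ] ⟫ ⇒[ c ] r → Alive r →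
                        ∃ (u ⟪ σ ⟫ ⇒[ c ]_) ⊎ UnguardedInLivePar σ u y
  live-step-of-update σ y aly (var x) st al with x ℕ.≟ y
  live-step-of-update σ y aly (var x) pre (_ , _ , ()) | yes refl
  ... | no _ = inj₁ (-, st)
  live-step-of-update σ y aly (c · t) pre al = inj₁ (-, pre)
  live-step-of-update σ y aly (t ⊕ u) (sumˡ st) al with live-step-of-update σ y aly t st al
  ... | inj₁ (_ , s) = inj₁ (-, sumˡ s)
  ... | inj₂ lp = inj₂ (⊕ˡ-InLivePar lp)
  live-step-of-update σ y aly (t ⊕ u) (sumʳ st) al with live-step-of-update σ y aly u st al
  ... | inj₁ (_ , s) = inj₁ (-, sumʳ s)
  ... | inj₂ lp = inj₂ (⊕ʳ-InLivePar lp)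
  live-step-of-update σ y aly (t ∥ u) (parˡ st) al with alive? (u ⟪ σ ⟫)
  ... | yes alu with step-of-update σ y _ t st
  ...   | inj₁ (_ , s) = inj₁ (-, parˡ s)
  ...   | inj₂ g = inj₂ (t , u , self , Unguarded-Alive g aly , alu , inj₁ g)
  live-step-of-update σ y aly (t ∥ u) (parˡ st) al | no ¬u
    with live-step-of-update σ y aly t st (Alive-∥-deadʳ al (dead-after-update σ y aly u ¬u))
  ... | inj₁ (_ , s) = inj₁ (-, parˡ s)
  ... | inj₂ lp = inj₂ (∥ˡ-InLivePar ¬u lp)
  live-step-of-update σ y aly (t ∥ u) (parʳ st) al with alive? (t ⟪ σ ⟫)
  ... | yes alt with step-of-update σ y _ u st
  ...   | inj₁ (_ , s) = inj₁ (-, parʳ s)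
  ...   | inj₂ g = inj₂ (t , u , self , alt , Unguarded-Alive g aly , inj₂ g)
  live-step-of-update σ y aly (t ∥ u) (parʳ st) al | no ¬t
    with live-step-of-update σ y aly u st (Alive-∥-deadˡ al (dead-after-update σ y aly t ¬t))
  ... | inj₁ (_ , s) = inj₁ (-, parʳ s)
  ... | inj₂ lp = inj₂ (∥ʳ-InLivePar ¬t lp)

  [↦]-step : ∀ σ y {c q} → (σ [ y ↦ c · q ]) y ⇒[ c ] q
  [↦]-step σ y = subst (_⇒[ _ ] _) (≡.sym ([↦]-≡ σ y _)) pre

  Unguarded-∥-live-step : Unguarded (t₁ ∥ t₂) y → Alive (t₁ ⟪ σ ⟫) → Alive (t₂ ⟪ σ ⟫) → σ y ⇒[ c ] r →
                          ∃ λ r' → (t₁ ∥ t₂) ⟪ σ ⟫ ⇒[ c ] r' × Alive r'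
  Unguarded-∥-live-step (∥ˡ g) _ (_ , _ , st₂) st with Unguarded-step g st
  ... | _ , st' , _ = -, parˡ st' , (-, -, parʳ st₂)
  Unguarded-∥-live-step (∥ʳ g) (_ , _ , st₁) _ st with Unguarded-step g st
  ... | _ , st' , _ = -, parʳ st' , (-, -, parˡ st₁)

  prefixDerivatives : (ℕ → P) → O → List P
  prefixDerivatives σ 𝟎 = []
  prefixDerivatives σ (var x) = []
  prefixDerivatives σ (c · t) = t ⟪ σ ⟫ ∷ []
  prefixDerivatives σ (t ⊕ u) = prefixDerivatives σ t ++ prefixDerivatives σ u
  prefixDerivatives σ (t ∥ u) =
    map (_∥ (u ⟪ σ ⟫)) (prefixDerivatives σ t) ++ map ((t ⟪ σ ⟫) ∥_) (prefixDerivatives σ u)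

  length-prefixDerivatives : ∀ σ t → length (prefixDerivatives σ t) ≤ size t
  length-prefixDerivatives σ 𝟎 = z≤n
  length-prefixDerivatives σ (var x) = z≤n
  length-prefixDerivatives σ (c · t) = s≤s z≤n
  length-prefixDerivatives σ (t ⊕ u)
    rewrite length-++ (prefixDerivatives σ t) {prefixDerivatives σ u} =
    ≤-trans (+-mono-≤ (length-prefixDerivatives σ t) (length-prefixDerivatives σ u)) (n≤1+n _)
  length-prefixDerivatives σ (t ∥ u)
    rewrite length-++ (map (_∥ (u ⟪ σ ⟫)) (prefixDerivatives σ t))
                      {map ((t ⟪ σ ⟫) ∥_) (prefixDerivatives σ u)}
          | length-map (_∥ (u ⟪ σ ⟫)) (prefixDerivatives σ t)
          | length-map ((t ⟪ σ ⟫) ∥_) (prefixDerivatives σ u) =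
    ≤-trans (+-mono-≤ (length-prefixDerivatives σ t) (length-prefixDerivatives σ u)) (n≤1+n _)

  UnguardedVarStep : (ℕ → P) → O → A → A → Set
  UnguardedVarStep σ t c e = ∃ λ z → Unguarded t z × ∃ λ r → σ z ⇒[ c ] r × Tr r (e ∷ [])

  step-source : ∀ σ t {c e d} → t ⟪ σ ⟫ ⇒[ c ] d → Tr d (e ∷ []) →
                d ∈ prefixDerivatives σ t ⊎ UnguardedVarStep σ t c e ⊎ Tr (t ⟪ σ ⟫) (e ∷ [])
  step-source σ (var z) st tr = inj₂ (inj₁ (z , self , -, st , tr))
  step-source σ (c · t) pre tr = inj₁ (here refl)
  step-source σ (t ⊕ u) (sumˡ st) tr with step-source σ t st tr
  ... | inj₁ m = inj₁ (∈-++⁺ˡ m)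
  ... | inj₂ (inj₁ (z , g , rest)) = inj₂ (inj₁ (z , ⊕ˡ g , rest))
  ... | inj₂ (inj₂ (_ , cons s nil)) = inj₂ (inj₂ (Tr-step (sumˡ s)))
  step-source σ (t ⊕ u) (sumʳ st) tr with step-source σ u st tr
  ... | inj₁ m = inj₁ (∈-++⁺ʳ (prefixDerivatives σ t) m)
  ... | inj₂ (inj₁ (z , g , rest)) = inj₂ (inj₁ (z , ⊕ʳ g , rest))
  ... | inj₂ (inj₂ (_ , cons s nil)) = inj₂ (inj₂ (Tr-step (sumʳ s)))
  step-source σ (t ∥ u) (parˡ st) (_ , cons (parʳ s) nil) = inj₂ (inj₂ (Tr-step (parʳ s)))
  step-source σ (t ∥ u) (parˡ st) (_ , cons (parˡ s) nil) with step-source σ t st (Tr-step s)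
  ... | inj₁ m = inj₁ (∈-++⁺ˡ (∈-map⁺ (_∥ (u ⟪ σ ⟫)) m))
  ... | inj₂ (inj₁ (z , g , rest)) = inj₂ (inj₁ (z , ∥ˡ g , rest))
  ... | inj₂ (inj₂ (_ , cons s' nil)) = inj₂ (inj₂ (Tr-step (parˡ s')))
  step-source σ (t ∥ u) (parʳ st) (_ , cons (parˡ s) nil) = inj₂ (inj₂ (Tr-step (parˡ s)))
  step-source σ (t ∥ u) (parʳ st) (_ , cons (parʳ s) nil) with step-source σ u st (Tr-step s)
  ... | inj₁ m =
    inj₁ (∈-++⁺ʳ (map (_∥ (u ⟪ σ ⟫)) (prefixDerivatives σ t)) (∈-map⁺ ((t ⟪ σ ⟫) ∥_) m))
  ... | inj₂ (inj₁ (z , g , rest)) = inj₂ (inj₁ (z , ∥ʳ g , rest))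
  ... | inj₂ (inj₂ (_ , cons s' nil)) = inj₂ (inj₂ (Tr-step (parʳ s')))

module Counterexample (k : ℕ) where

  open Processes (suc (suc k))

  a b : A
  a = zero
  b = suc zero

  private variable
    c : A
    α : List A
    i j N : ℕ
    p p' r s s₁ s₂ : P

  B : ℕ → P
  B zero = a · 𝟎
  B (suc j) = b · B j

  Bsum ABsum : ℕ → P
  Bsum zero = 𝟎
  Bsum (suc N) = Bsum N ⊕ (a · B (suc N))
  ABsum zero = 𝟎
  ABsum (suc N) = ABsum N ⊕ (a · ((a · 𝟎) ∥ B (suc N)))

  L R : ℕ → P
  L N = (a · 𝟎) ∥ Bsum N
  R N = (a · (𝟎 ∥ Bsum N)) ⊕ ABsum N

  L′₀ : ℕ → P
  L′₀ N = 𝟎 ∥ Bsum N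

  L′ : ℕ → P
  L′ j = (a · 𝟎) ∥ B j

  Bsum-step : Bsum N ⇒[ c ] p → c ≡ a × ∃ λ i → 1 ≤ i × i ≤ N × p ≡ B i
  Bsum-step {suc N} (sumˡ s) with Bsum-step s
  ... | c≡a , i , 1≤i , i≤N , refl = c≡a , i , 1≤i , m≤n⇒m≤1+n i≤N , refl
  Bsum-step {suc N} (sumʳ pre) = refl , suc N , s≤s z≤n , ≤-refl , refl

  Bsum-step⁻ : 1 ≤ i → i ≤ N → Bsum N ⇒[ a ] B i
  Bsum-step⁻ {N = zero} (s≤s _) ()
  Bsum-step⁻ {N = suc N} 1≤i i≤1+N with m≤n⇒m<n∨m≡n i≤1+N
  ... | inj₁ (s≤s i≤N) = sumˡ (Bsum-step⁻ 1≤i i≤N)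
  ... | inj₂ refl = sumʳ pre

  ABsum-step : ABsum N ⇒[ c ] r → ∃ λ p → Bsum N ⇒[ c ] p × r ≡ (a · 𝟎) ∥ p
  ABsum-step {suc N} (sumˡ s) with ABsum-step s
  ... | _ , s' , refl = -, sumˡ s' , refl
  ABsum-step {suc N} (sumʳ pre) = -, sumʳ pre , refl

  ABsum-step⁻ : Bsum N ⇒[ c ] p → ABsum N ⇒[ c ] (a · 𝟎) ∥ p
  ABsum-step⁻ {suc N} (sumˡ s) = sumˡ (ABsum-step⁻ s)
  ABsum-step⁻ {suc N} (sumʳ pre) = sumʳ pre

  L-R-SameSteps : ∀ N → SameSteps (L N) (R N)
  L-R-SameSteps N = L⇒R , R⇒L
    where
      L⇒R : L N ⇒[ c ] r → R N ⇒[ c ] r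
      L⇒R (parˡ pre) = sumˡ pre
      L⇒R (parʳ s) = sumʳ (ABsum-step⁻ s)
      R⇒L : R N ⇒[ c ] r → L N ⇒[ c ] r
      R⇒L (sumˡ pre) = parˡ pre
      R⇒L (sumʳ s) with ABsum-step s
      ... | _ , s' , refl = parʳ s'

  L-step : L N ⇒[ c ] r → c ≡ a × (r ≡ L′₀ N ⊎ ∃ λ i → 1 ≤ i × i ≤ N × r ≡ L′ i)
  L-step (parˡ pre) = refl , inj₁ refl
  L-step (parʳ s) with Bsum-step s
  ... | refl , i , 1≤i , i≤N , refl = refl , inj₂ (i , 1≤i , i≤N , refl)

  b^_ : ℕ → List A
  b^ i = replicate i b

  occ : A → List A → ℕ
  occ c [] = 0
  occ c (d ∷ α) = if does (d ≟ c) then suc (occ c α) else occ c α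

  occ-++ : ∀ c α {β} → occ c (α ++ β) ≡ occ c α + occ c β
  occ-++ c [] = refl
  occ-++ c (d ∷ α) with does (d ≟ c)
  ... | true = cong suc (occ-++ c α)
  ... | false = occ-++ c α

  occ-interleaving : ∀ c {α β γ} → Interleaving β γ α → occ c α ≡ occ c β + occ c γ
  occ-interleaving c [] = refl
  occ-interleaving c {d ∷ _} (consˡ i) with does (d ≟ c)
  ... | true = cong suc (occ-interleaving c i)
  ... | false = occ-interleaving c i
  occ-interleaving c {d ∷ _} {β} (consʳ i) with does (d ≟ c)
  ... | true = ≡.trans (cong suc (occ-interleaving c i)) (≡.sym (+-suc (occ c β) _))
  ... | false = occ-interleaving c i

  occ-a-b^ : ∀ i → occ a (b^ i) ≡ 0
  occ-a-b^ zero = refl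
  occ-a-b^ (suc i) = occ-a-b^ i

  occ-b-b^ : ∀ i → occ b (b^ i) ≡ i
  occ-b-b^ zero = refl
  occ-b-b^ (suc i) = cong suc (occ-b-b^ i)

  B-b^ : ∀ j → B j ⇒*[ b^ j ] a · 𝟎
  B-b^ zero = nil
  B-b^ (suc j) = cons pre (B-b^ j)

  Tr-a𝟎-occ : Tr (a · 𝟎) α → occ a α ≤ 1 × occ b α ≡ 0
  Tr-a𝟎-occ (_ , nil) = z≤n , refl
  Tr-a𝟎-occ (_ , cons pre nil) = ≤-refl , refl

  Tr-B-occ : ∀ j → Tr (B j) α → (occ a α ≡ 0 × occ b α ≤ j) ⊎ (occ a α ≡ 1 × occ b α ≡ j)
  Tr-B-occ j (_ , nil) = inj₁ (refl , z≤n)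
  Tr-B-occ zero (_ , cons pre nil) = inj₂ (refl , refl)
  Tr-B-occ (suc j) (_ , cons pre π) with Tr-B-occ j (-, π)
  ... | inj₁ (a₀ , b≤j) = inj₁ (a₀ , s≤s b≤j)
  ... | inj₂ (a₁ , b≡j) = inj₂ (a₁ , cong suc b≡j)

  Tr-B-occ-b : ∀ j → Tr (B j) α → occ b α ≤ j
  Tr-B-occ-b j tr with Tr-B-occ j tr
  ... | inj₁ (_ , b≤j) = b≤j
  ... | inj₂ (_ , b≡j) = ≤-reflexive b≡j

  L′-occ-b : ∀ j → Tr (L′ j) α → occ b α ≤ j
  L′-occ-b j tr with Tr-∥-interleaving tr
  ... | _ , _ , il , tr₁ , tr₂ rewrite occ-interleaving b il | proj₂ (Tr-a𝟎-occ tr₁) = Tr-B-occ-b j tr₂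

  L′-b : 1 ≤ j → Tr (L′ j) (b ∷ [])
  L′-b {suc j} _ = Tr-step (parʳ pre)

  L′-b^ : ∀ j → Tr (L′ j) (b^ j)
  L′-b^ j = Tr-∥ʳ (-, B-b^ j)

  L′-b^-≤ : Tr (L′ j) (b^ i) → i ≤ j
  L′-b^-≤ {j} {i} tr = subst (_≤ j) (occ-b-b^ i) (L′-occ-b j tr)

  L′-ac : 1 ≤ j → Tr (L′ j) (a ∷ c ∷ []) → c ≡ b
  L′-ac {suc j} _ (_ , cons (parˡ pre) (cons (parʳ pre) nil)) = refl
  L′-ac {suc j} _ (_ , cons (parˡ pre) (cons (parˡ ()) nil))

  L′-no-b^ab : ¬ Tr (L′ j) (b^ j ++ a ∷ b ∷ [])
  L′-no-b^ab {j} tr = <-irrefl refl (subst (_≤ j) count (L′-occ-b j tr))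
    where
      count : occ b (b^ j ++ a ∷ b ∷ []) ≡ suc j
      count = ≡.trans (occ-++ b (b^ j)) (≡.trans (cong (_+ 1) (occ-b-b^ j)) (+-comm j 1))

  L′-ab^a : Tr (L′ j) (a ∷ b^ i ++ a ∷ []) → i ≡ j
  L′-ab^a {j} {i} tr with Tr-∥-interleaving tr
  ... | β , γ , il , tr₁ , tr₂ =
    from-occ (Tr-a𝟎-occ tr₁) (Tr-B-occ j tr₂)
      (≡.trans (≡.sym occ-a) (occ-interleaving a il)) (≡.trans (≡.sym occ-b) (occ-interleaving b il))
    where
      occ-a : occ a (a ∷ b^ i ++ a ∷ []) ≡ 2
      occ-a = cong suc (≡.trans (occ-++ a (b^ i)) (cong (_+ 1) (occ-a-b^ i)))
      occ-b : occ b (a ∷ b^ i ++ a ∷ []) ≡ i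
      occ-b = ≡.trans (occ-++ b (b^ i)) (≡.trans (cong (_+ 0) (occ-b-b^ i)) (+-identityʳ i))
      from-occ : occ a β ≤ 1 × occ b β ≡ 0 →
                 (occ a γ ≡ 0 × occ b γ ≤ j) ⊎ (occ a γ ≡ 1 × occ b γ ≡ j) →
                 2 ≡ occ a β + occ a γ → i ≡ occ b β + occ b γ → i ≡ j
      from-occ (a≤1 , _) (inj₁ (a₀ , _)) two _ rewrite a₀ | +-identityʳ (occ a β) =
        ⊥-elim (<-irrefl refl (subst (_≤ 1) (≡.sym two) a≤1))
      from-occ (_ , b₀) (inj₂ (_ , bⱼ)) _ i≡ rewrite b₀ | bⱼ = i≡

  L′₀-no-b : ¬ Tr (L′₀ N) (b ∷ [])
  L′₀-no-b (_ , cons (parʳ s) nil) with Bsum-step s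
  ... | () , _

  L′₀-ab^a : 1 ≤ i → i ≤ N → Tr (L′₀ N) (a ∷ b^ i ++ a ∷ [])
  L′₀-ab^a {i} 1≤i i≤N = Tr-∷ (parʳ (Bsum-step⁻ 1≤i i≤N)) (Tr-∥ʳ (-, ⇒*-++ (B-b^ i) (cons pre nil)))

  -- The invariant

  module Bound (N : ℕ) (1≤N : 1 ≤ N) where

    initial-a : p ⊑F L N → p ⇒[ c ] p' → c ≡ a
    initial-a below st = proj₁ (L-step (proj₁ (proj₂ (below st))))

    no-b : p ⊑F L N → ¬ p ⇒[ b ] p'
    no-b below st with initial-a below st
    ... | ()

    a-derivative : p ⊑F L N → p ⇒[ a ] p' → p' ≃Tr L′₀ N ⊎ ∃ λ j → 1 ≤ j × j ≤ N × p' ≃Tr L′ j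
    a-derivative below st with below st
    ... | _ , st' , e with L-step st'
    ...   | _ , inj₁ refl = inj₁ e
    ...   | _ , inj₂ (j , 1≤j , j≤N , refl) = inj₂ (j , 1≤j , j≤N , e)

    b-capable-a-derivative : p ⊑F L N → p ⇒[ a ] p' → Tr p' (b ∷ []) →
                             ∃ λ j → 1 ≤ j × j ≤ N × p' ≃Tr L′ j
    b-capable-a-derivative below st tr with a-derivative below st
    ... | inj₁ e = ⊥-elim (L′₀-no-b (proj₁ e tr))
    ... | inj₂ x = x

    L-⊑F-intro : (∃ λ d → s ⇒[ a ] d × L′₀ N ≃Tr d) →
                 (∀ {i} → 1 ≤ i → i ≤ N → ∃ λ d → s ⇒[ a ] d × L′ i ≃Tr d) → L N ⊑F s
    L-⊑F-intro match₀ matchᵢ st with L-step st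
    ... | refl , inj₁ refl = match₀
    ... | refl , inj₂ (i , 1≤i , i≤N , refl) = matchᵢ 1≤i i≤N

    -- s₁ and s₂ can only start with a.  As r can do b, s₁ ∥ r is some a.0 ∥ Bⱼ up to traces, which
    -- forces the a-derivative s₁' of s₁ to be dead; then s₁' ∥ s₂ must be 0 ∥ Σ a.Bᵢ, so s₂ alone
    -- supplies every trace a bⁱ a, and the matching a-derivatives s₁ ∥ rᵢ of s₁ ∥ s₂ are a.0 ∥ Bᵢ.
    parallel-⊑F-L⇒L-⊑F : (s₁ ∥ s₂) ⊑F L N → Alive s₁ → s₂ ⇒[ a ] r → Tr r (b ∷ []) →
                         L N ⊑F (s₁ ∥ s₂)
    parallel-⊑F-L⇒L-⊑F {s₁} {s₂} below (_ , s₁' , st₁) st₂ tr with initial-a below (parˡ st₁)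
    ... | refl = L-⊑F-intro (-, parˡ st₁ , ≃Tr-sym match₀) matchᵢ
      where
        no-b₁ : ∀ {p'} → ¬ s₁ ⇒[ b ] p'
        no-b₁ st = no-b below (parˡ st)

        dead₁' : ¬ Alive s₁'
        dead₁' (_ , _ , st) with b-capable-a-derivative below (parʳ st₂) (Tr-∥ʳ tr)
        ... | j , 1≤j , _ , (to , from) with L′-ac 1≤j (to (Tr-∷ (parˡ st₁) (Tr-step (parˡ st))))
        ...   | refl with Tr-∥-no-initialˡ j no-b₁ (from (L′-b^ j))
        ...     | _ , π = L′-no-b^ab (to (-, ⇒*-++ (⇒*-∥ʳ π) (cons (parˡ st₁) (cons (parˡ st) nil))))

        match₀ : (s₁' ∥ s₂) ≃Tr L′₀ N
        match₀ with a-derivative below (parˡ st₁)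
        ... | inj₁ e = e
        ... | inj₂ (j , 1≤j , _ , (_ , from)) with ∥-deadˡ-⊆Tr dead₁' (from (L′-b 1≤j))
        ...   | _ , cons st nil = ⊥-elim (no-b below (parʳ st))

        matchᵢ : ∀ {i} → 1 ≤ i → i ≤ N → ∃ λ d → (s₁ ∥ s₂) ⇒[ a ] d × L′ i ≃Tr d
        matchᵢ {suc i} 1≤i i≤N with ∥-deadˡ-⊆Tr dead₁' (proj₂ match₀ (L′₀-ab^a 1≤i i≤N))
        ... | _ , cons stᵢ π@(cons st-b _)
            with b-capable-a-derivative below (parʳ stᵢ) (Tr-∥ʳ (Tr-step st-b))
        ...   | j , _ , _ , e with L′-ab^a {i = suc i} (proj₁ e (Tr-∷ (parˡ st₁) (Tr-∥ʳ (-, π))))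
        ...     | refl = -, parʳ stᵢ , ≃Tr-sym e

    ParSummand⊒L : P → Set
    ParSummand⊒L p = ∃₂ λ s₁ s₂ → Summand p (s₁ ∥ s₂) × Alive s₁ × Alive s₂ × L N ⊑F (s₁ ∥ s₂)

    ParSummand⊒L-Summand : Summand p s → ParSummand⊒L s → ParSummand⊒L p
    ParSummand⊒L-Summand sm (s₁ , s₂ , sm' , rest) = s₁ , s₂ , Summand-trans sm sm' , rest

    ParSummand⊒L-L : ParSummand⊒L (L N)
    ParSummand⊒L-L = -, -, self , (-, -, pre) , (-, -, Bsum-step⁻ ≤-refl 1≤N) , ⊑F-refl

    ¬ParSummand⊒L-R : ¬ ParSummand⊒L (R N)
    ¬ParSummand⊒L-R (_ , _ , ⊕ʳ sm , _) = no-parallel-summand N sm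
      where
        no-parallel-summand : ∀ N → ¬ Summand (ABsum N) (s₁ ∥ s₂)
        no-parallel-summand (suc N) (⊕ˡ sm) = no-parallel-summand N sm

    ParSummand⊒L-ab : ParSummand⊒L p → ∃ λ r → p ⇒[ a ] r × Tr r (b ∷ [])
    ParSummand⊒L-ab (_ , _ , sm , _ , _ , above) with above (parʳ (Bsum-step⁻ ≤-refl 1≤N))
    ... | _ , st , (to , _) with Summand-⊑F sm st
    ...   | _ , st' , (to' , _) = -, st' , to' (to (L′-b ≤-refl))

    UnguardedInLivePar-⊒L : ∀ {σ u y} → u ⟪ σ ⟫ ⊑F L N → σ y ⇒[ a ] r → Tr r (b ∷ []) →
                            UnguardedInLivePar σ u y → ParSummand⊒L (u ⟪ σ ⟫)
    UnguardedInLivePar-⊒L {σ = σ} {y = y} below st tr (u₁ , u₂ , os , al₁ , al₂ , g) =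
      ParSummand⊒L-Summand summand (-, -, self , al₁ , al₂ , above g)
      where
        summand : Summand _ (u₁ ⟪ σ ⟫ ∥ u₂ ⟪ σ ⟫)
        summand = OpenSummand-⟪⟫ os
        below′ : (u₁ ⟪ σ ⟫ ∥ u₂ ⟪ σ ⟫) ⊑F L N
        below′ = ⊑F-trans (Summand-⊑F summand) below
        above : Unguarded u₁ y ⊎ Unguarded u₂ y → L N ⊑F (u₁ ⟪ σ ⟫ ∥ u₂ ⟪ σ ⟫)
        above (inj₂ g₂) with Unguarded-step g₂ st
        ... | _ , st₂ , r⊆ = parallel-⊑F-L⇒L-⊑F below′ al₁ st₂ (r⊆ tr)
        above (inj₁ g₁) with Unguarded-step g₁ st
        ... | _ , st₁ , r⊆ =
          ⊑F-trans (parallel-⊑F-L⇒L-⊑F (⊑F-trans ∥-comm-⊑F below′) al₂ st₁ (r⊆ tr)) ∥-comm-⊑F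

    -- The a-derivatives a.0 ∥ Bᵢ (1 ≤ i ≤ N) of L N are pairwise trace inequivalent, and w has fewer
    -- than N prefix derivatives, so by pigeonhole one of them is reached through a variable.
    a-derivatives-from-variable : ∀ σ w → size w < N → ¬ Tr (w ⟪ σ ⟫) (b ∷ []) → L N ⊑F w ⟪ σ ⟫ →
                                  UnguardedVarStep σ w a b
    a-derivatives-from-variable σ w small no-b-w above =
      [ not-all-prefix , (λ v → v) ]′ (all-or-some N source)
      where
        idx : Fin N → ℕ
        idx i = suc (toℕ i)

        derivative : ∀ i → ∃ λ d → w ⟪ σ ⟫ ⇒[ a ] d × L′ (idx i) ≃Tr d
        derivative i = above (parʳ (Bsum-step⁻ (s≤s z≤n) (toℕ<n i)))

        source : ∀ i → proj₁ (derivative i) ∈ prefixDerivatives σ w ⊎ UnguardedVarStep σ w a b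
        source i with derivative i
        ... | _ , st , (to , _) with step-source σ w st (to (L′-b (s≤s z≤n)))
        ...   | inj₁ m = inj₁ m
        ...   | inj₂ (inj₁ v) = inj₂ v
        ...   | inj₂ (inj₂ tr) = ⊥-elim (no-b-w tr)

        not-all-prefix : (∀ i → proj₁ (derivative i) ∈ prefixDerivatives σ w) → UnguardedVarStep σ w a b
        not-all-prefix ∈pd
          with pigeonhole (≤-trans (s≤s (length-prefixDerivatives σ w)) small) (index ∘ ∈pd)
        ... | i , j , i<j , same-index = ⊥-elim (<-irrefl refl (≤-trans (s≤s i<j) (L′-b^-≤ tr)))
          where
            same : proj₁ (derivative i) ≡ proj₁ (derivative j)
            same = ≡.trans (lookup-index (∈pd i))
                           (≡.trans (cong (lookup (prefixDerivatives σ w)) same-index)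
                                    (≡.sym (lookup-index (∈pd j))))
            tr : Tr (L′ (idx i)) (b^ idx j)
            tr = proj₂ (proj₂ (proj₂ (derivative i)))
                   (subst (λ d → Tr d (b^ idx j)) (≡.sym same)
                          (proj₁ (proj₂ (proj₂ (derivative j))) (L′-b^ (idx j))))

    -- Replacing x by b.0 lets t, hence u, perform b; since u ⟪ σ ⟫ cannot, x is unguarded in u.
    variable-summand-⊒L : ∀ {σ} t u x → OpenSummand σ t (var x) → (∀ σ → t ⟪ σ ⟫ ⊑F u ⟪ σ ⟫) →
                          u ⟪ σ ⟫ ⊑F L N → ParSummand⊒L (σ x) → ParSummand⊒L (u ⟪ σ ⟫)
    variable-summand-⊒L {σ} t u x os t⊑u below φ
      with ParSummand⊒L-ab φ | Unguarded-step (OpenSummand-Unguarded os self) ([↦]-step σ x {b} {𝟎})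
    ... | _ , st , tr | _ , tst , _ with step-of-update σ x _ u (proj₁ (proj₂ (t⊑u _ tst)))
    ...   | inj₁ (_ , ust) = ⊥-elim (no-b below ust)
    ...   | inj₂ g with unguarded-split (-, -, st) g
    ...     | inj₁ os′ = ParSummand⊒L-Summand (OpenSummand-⟪⟫ os′) φ
    ...     | inj₂ lp = UnguardedInLivePar-⊒L below st tr lp

    -- Replacing y by b.0 gives t a b-step to a live process, which u can only match if y is
    -- unguarded in a parallel summand of u with two live components.
    parallel-summand-⊒L : ∀ {σ} t u t₁ t₂ → size t < N → OpenSummand σ t (t₁ ∥ t₂) →
                          Alive (t₁ ⟪ σ ⟫) → Alive (t₂ ⟪ σ ⟫) → L N ⊑F (t₁ ∥ t₂) ⟪ σ ⟫ →
                          (∀ σ → t ⟪ σ ⟫ ⊑F u ⟪ σ ⟫) → t ⟪ σ ⟫ ⊑F L N → u ⟪ σ ⟫ ⊑F L N →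
                          ParSummand⊒L (u ⟪ σ ⟫)
    parallel-summand-⊒L {σ} t u t₁ t₂ small os al₁ al₂ above t⊑u below-t below-u
      with a-derivatives-from-variable σ (t₁ ∥ t₂) (≤-trans (s≤s (OpenSummand-size os)) small)
                                       no-b-w above
      where
        no-b-w : ¬ Tr ((t₁ ∥ t₂) ⟪ σ ⟫) (b ∷ [])
        no-b-w (_ , cons st nil) = no-b (⊑F-trans (Summand-⊑F (OpenSummand-⟪⟫ os)) below-t) st
    ... | y , g , _ , st , tr
      with Unguarded-∥-live-step g (Alive-⟪⟫ live t₁ al₁) (Alive-⟪⟫ live t₂ al₂) ([↦]-step σ y {b} {𝟎})
      where
        live : ∀ x → Alive (σ x) → Alive ((σ [ y ↦ b · 𝟎 ]) x)
        live = Alive-[↦]⁺ σ y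
    ...   | _ , wst , alw with OpenSummand-live-step os wst alw
    ...     | _ , tst , alt with t⊑u _ tst
    ...       | _ , ust , (to , _) with live-step-of-update σ y (-, -, st) u ust (⊆Tr-Alive to alt)
    ...         | inj₁ (_ , ust′) = ⊥-elim (no-b below-u ust′)
    ...         | inj₂ lp = UnguardedInLivePar-⊒L below-u st tr lp

    -- The hypothesis p ⊑F L N is carried along derivations by soundness modulo ≈F.
    Transfers : P → P → Set
    Transfers p q = p ⊑F L N → ParSummand⊒L p → ParSummand⊒L q

    ·-Transfers : ∀ c {p q} → Transfers (c · p) (c · q)
    ·-Transfers c _ (_ , _ , () , _)

    ⊕-Transfers : ∀ {p p' q q'} → Transfers p p' → Transfers q q' → Transfers (p ⊕ q) (p' ⊕ q')
    ⊕-Transfers tp tq below (s₁ , s₂ , ⊕ˡ sm , rest) =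
      ParSummand⊒L-Summand (⊕ˡ self)
        (tp (⊑F-trans (Summand-⊑F (⊕ˡ self)) below) (s₁ , s₂ , sm , rest))
    ⊕-Transfers tp tq below (s₁ , s₂ , ⊕ʳ sm , rest) =
      ParSummand⊒L-Summand (⊕ʳ self)
        (tq (⊑F-trans (Summand-⊑F (⊕ʳ self)) below) (s₁ , s₂ , sm , rest))

    ∥-Transfers : ∀ {p p' q q'} → Transfers p p' → Transfers q q' → p ≈F p' → q ≈F q' →
                  Transfers (p ∥ q) (p' ∥ q')
    ∥-Transfers tp tq ep eq below (_ , _ , self , al₁ , al₂ , above) =
      -, -, self , ⊑F-Alive (proj₁ ep) al₁ , ⊑F-Alive (proj₁ eq) al₂ ,
      ⊑F-trans above (proj₁ (∥-cong-≈F ep eq))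
    ∥-Transfers tp tq ep eq below (s₁ , s₂ , ∥ˡ sm ¬q , rest) =
      ParSummand⊒L-Summand (∥ˡ self (λ al → ¬q (⊑F-Alive (proj₂ eq) al)))
        (tp (⊑F-trans (Summand-⊑F (∥ˡ self ¬q)) below) (s₁ , s₂ , sm , rest))
    ∥-Transfers tp tq ep eq below (s₁ , s₂ , ∥ʳ sm ¬p , rest) =
      ParSummand⊒L-Summand (∥ʳ self (λ al → ¬p (⊑F-Alive (proj₂ ep) al)))
        (tq (⊑F-trans (Summand-⊑F (∥ʳ self ¬p)) below) (s₁ , s₂ , sm , rest))

    instance-Transfers : ∀ t u → size t < N → (∀ σ → t ⟪ σ ⟫ ≈F u ⟪ σ ⟫) →
                         ∀ σ → Transfers (t ⟪ σ ⟫) (u ⟪ σ ⟫)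
    instance-Transfers t u small t≈u σ below (s₁ , s₂ , sm , al₁ , al₂ , above) =
      [ (λ (x , os , smx) →
             variable-summand-⊒L t u x os t⊑u below-u (s₁ , s₂ , smx , al₁ , al₂ , above))
      , (λ { (t₁ , t₂ , os , refl , refl) →
             parallel-summand-⊒L t u t₁ t₂ small os al₁ al₂ above t⊑u below below-u })
      ]′ (summand-of-instance t sm)
      where
        t⊑u : ∀ σ → t ⟪ σ ⟫ ⊑F u ⟪ σ ⟫
        t⊑u σ = proj₁ (t≈u σ)
        below-u : u ⟪ σ ⟫ ⊑F L N
        below-u = ⊑F-trans (proj₂ (t≈u σ)) below

    module _ (E : List (Equation (suc (suc k)))) (E-sound : SoundModulo (suc (suc k)) _≈F_ E)
             (E-small : ∀ t u → (t , u) ∈ E → size t < N × size u < N) where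

      ⊢-Transfers : ∀ {t u} → _⊢_≈_ (suc (suc k)) E t u → ∀ σ →
                    Transfers (t ⟪ σ ⟫) (u ⟪ σ ⟫) × Transfers (u ⟪ σ ⟫) (t ⟪ σ ⟫)
      ⊢-Transfers (ax {t} {u} t≈u∈E) σ =
        instance-Transfers t u (proj₁ (E-small t u t≈u∈E)) (E-sound t u t≈u∈E) σ ,
        instance-Transfers u t (proj₂ (E-small t u t≈u∈E)) (λ σ → ≈F-sym (E-sound t u t≈u∈E σ)) σ
      ⊢-Transfers refl σ = (λ _ φ → φ) , (λ _ φ → φ)
      ⊢-Transfers (sym d) σ = proj₂ (⊢-Transfers d σ) , proj₁ (⊢-Transfers d σ)
      ⊢-Transfers (trans d₁ d₂) σ =
        (λ below φ → proj₁ (⊢-Transfers d₂ σ) (⊑F-trans (proj₂ (⊢-sound-≈F E-sound d₁ σ)) below)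
                                              (proj₁ (⊢-Transfers d₁ σ) below φ)) ,
        (λ below φ → proj₂ (⊢-Transfers d₁ σ) (⊑F-trans (proj₁ (⊢-sound-≈F E-sound d₂ σ)) below)
                                              (proj₂ (⊢-Transfers d₂ σ) below φ))
      ⊢-Transfers (inst {t} {u} τ d) σ =
        subst₂ (λ p q → Transfers p q × Transfers q p) (≡.sym (⟪⟫-⟪⟫ t τ σ)) (≡.sym (⟪⟫-⟪⟫ u τ σ))
               (⊢-Transfers d (λ z → τ z ⟪ σ ⟫))
      ⊢-Transfers (cong· c d) σ = ·-Transfers c , ·-Transfers c
      ⊢-Transfers (cong⊕ d₁ d₂) σ =
        ⊕-Transfers (proj₁ (⊢-Transfers d₁ σ)) (proj₁ (⊢-Transfers d₂ σ)) ,
        ⊕-Transfers (proj₂ (⊢-Transfers d₁ σ)) (proj₂ (⊢-Transfers d₂ σ))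
      ⊢-Transfers (cong∥ d₁ d₂) σ =
        ∥-Transfers (proj₁ (⊢-Transfers d₁ σ)) (proj₁ (⊢-Transfers d₂ σ))
                    (⊢-sound-≈F E-sound d₁ σ) (⊢-sound-≈F E-sound d₂ σ) ,
        ∥-Transfers (proj₂ (⊢-Transfers d₁ σ)) (proj₂ (⊢-Transfers d₂ σ))
                    (≈F-sym (⊢-sound-≈F E-sound d₁ σ)) (≈F-sym (⊢-sound-≈F E-sound d₂ σ))

  no-finite-axiomatisation : ∀ {ℓ} (_∼_ : P → P → Set ℓ) → (∀ {p q} → p ∼ q → p ≈F q) →
                             (∀ N → L N ∼ R N) → ¬ HasFiniteGroundCompleteAxiomatisation (suc (suc k)) _∼_
  no-finite-axiomatisation _∼_ ∼⇒≈F L∼R (E , E-sound , E-complete) =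
    ¬ParSummand⊒L-R (L-Transfers-R ⊑F-refl ParSummand⊒L-L)
    where
      N₀ : ℕ
      N₀ = suc (equationsSize E)
      open Bound N₀ (s≤s z≤n)
      E-sound-≈F : SoundModulo (suc (suc k)) _≈F_ E
      E-sound-≈F t u t≈u∈E σ = ∼⇒≈F (E-sound t u t≈u∈E σ)
      L-Transfers-R : Transfers (L N₀) (R N₀)
      L-Transfers-R =
        subst₂ Transfers (emb-⟪⟫ (L N₀) (λ _ → 𝟎)) (emb-⟪⟫ (R N₀) (λ _ → 𝟎))
          (proj₁ (⊢-Transfers E E-sound-≈F (size<1+equationsSize E)
                               (E-complete (L N₀) (R N₀) (L∼R N₀)) (λ _ → 𝟎)))

theorem6p15 : (k : ℕ) → 2 ≤ k → (n : ℕ) → 2 ≤ n →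
    ¬ HasFiniteGroundCompleteAxiomatisation k (λ p q → _∼T[_]_ k p n q) ×
    ¬ HasFiniteGroundCompleteAxiomatisation k (λ p q → _∼S[_]_ k p n q)
theorem6p15 (suc (suc k)) (s≤s (s≤s z≤n)) (suc (suc n)) (s≤s (s≤s z≤n)) =
  no-finite-axiomatisation _ (∼T-≈F n) (λ N → SameSteps-∼T (2 + n) (L-R-SameSteps N)) ,
  no-finite-axiomatisation _ (∼S-≈F n) (λ N → SameSteps-∼S (2 + n) (L-R-SameSteps N))
  where
    open Processes (suc (suc k))
    open Counterexample k
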